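{- Let $A=(a_{ij})_{i,j\in I}$ be a symmetric (nonsingular) generalized Cartan matrix with $|a_{ij}|\ge2$ for all $i,j\in I$. Then the root system of the Kac--Moody algebra $\mathfrak g(A)$ has the following property: every nontrivial $w\in W$ can be written as $w=v\,w_\beta$, where $\beta$ is a simple root, $\ell(v)<\ell(w)$, and $\alpha-\beta$ is not a real root for any $\alpha\in\Phi_v$.
   Context: Here $I=\{1,\dots,r\}$, the Kac--Moody algebra $\mathfrak g(A)$ has Cartan $\mathfrak h$, simple roots $\alpha_i$, simple coroots $\alpha_i^\vee$ with $\langle\alpha_j,\alpha_i^\vee\rangle=a_{ij}$, roots $\Phi=\Phi_+\sqcup\Phi_-$, Weyl group $W$ generated by simple reflections $w_\beta$ ($\beta$ simple), length function $\ell$, and $\Phi_v=\Phi_+\cap v^{ -1}\Phi_-$. A root is real if it is $W$-conjugate to a simple root. The paper assumes throughout that generalized Cartan matrices are nonsingular. -}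

module Defs where

open import Data.Nat using (ℕ; zero; suc) renaming (_≤_ to _≤ℕ_; _<_ to _<ℕ_)
open import Data.Integer using (ℤ; +_; _+_; _-_; _*_; -_; _≤_; ∣_∣)
open import Data.Fin using (Fin; zero; suc)
open import Data.List using (List; []; _∷_; length)
open import Data.Product using (Σ; _×_; ∃)
open import Relation.Binary.PropositionalEquality using (_≡_; _≢_)
open import Relation.Nullary using (¬_)

Matrix : ℕ → Set
Matrix r = Fin r → Fin r → ℤ

-- Elements of the root lattice Q = ⊕ ℤ αᵢ, as coefficient vectors.
Vec𝕫 : ℕ → Set
Vec𝕫 r = Fin r → ℤ

_≋_ : ∀ {r} → Vec𝕫 r → Vec𝕫 r → Set
α ≋ β = ∀ j → α j ≡ β j

sumFin : ∀ n → (Fin n → ℤ) → ℤ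
sumFin zero f = + 0
sumFin (suc n) f = f zero + sumFin n (λ j → f (suc j))

record IsGCM {r} (a : Matrix r) : Set where
  field
    diag    : ∀ i → a i i ≡ + 2
    offdiag : ∀ i j → i ≢ j → a i j ≤ + 0
    zeroSym : ∀ i j → a i j ≡ + 0 → a j i ≡ + 0

IsSymmetric : ∀ {r} → Matrix r → Set
IsSymmetric a = ∀ i j → a i j ≡ a j i

-- nonsingular: trivial kernel (over ℤ, equivalently over ℚ)
IsNonsingular : ∀ {r} → Matrix r → Set
IsNonsingular {r} a = ∀ (x : Vec𝕫 r) → (∀ i → sumFin r (λ j → a i j * x j) ≡ + 0) → ∀ j → x j ≡ + 0

module KacMoody {r : ℕ} (a : Matrix r) where

  e : Fin r → Vec𝕫 r
  e i j with i Data.Fin.≟ j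
  ... | Relation.Nullary.yes _ = + 1
  ... | Relation.Nullary.no  _ = + 0

  _⊖_ : Vec𝕫 r → Vec𝕫 r → Vec𝕫 r
  (α ⊖ β) j = α j - β j

  neg : Vec𝕫 r → Vec𝕫 r
  neg α j = - α j

  -- ⟨α, αᵢ^∨⟩ with ⟨αⱼ, αᵢ^∨⟩ = a i j
  pair : Vec𝕫 r → Fin r → ℤ
  pair α i = sumFin r (λ j → α j * a i j)

  refl : Fin r → Vec𝕫 r → Vec𝕫 r
  refl i α j = α j - pair α i * e i j

  -- Weyl group elements are represented by words in the simple reflections;
  -- the word i₁ ∷ … ∷ iₖ stands for w_{α_{i₁}} ⋯ w_{α_{iₖ}}.
  Word : Set
  Word = List (Fin r)

  act : Word → Vec𝕫 r → Vec𝕫 r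
  act [] α = α
  act (i ∷ w) α = refl i (act w α)

  -- equality in W (W acts faithfully on h* = Q ⊗ ℂ since A is nonsingular)
  _≈W_ : Word → Word → Set
  w ≈W w' = ∀ α → act w α ≋ act w' α

  IsLength : Word → ℕ → Set
  IsLength w n = (Σ Word λ w' → (w' ≈W w) × (length w' ≡ n))
               × (∀ w' → w' ≈W w → n ≤ℕ length w')

  IsReal : Vec𝕫 r → Set
  IsReal α = Σ Word λ w → Σ (Fin r) λ i → α ≋ act w (e i)

  Nonneg : Vec𝕫 r → Set
  Nonneg α = ∀ j → + 0 ≤ α j

  data SuppPath (α : Vec𝕫 r) : Fin r → Fin r → Set where
    here : ∀ {j} → α j ≢ + 0 → SuppPath α j j
    step : ∀ {j l k} → α j ≢ + 0 → a j l ≢ + 0 → SuppPath α l k → SuppPath α j k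

  ConnectedSupp : Vec𝕫 r → Set
  ConnectedSupp α = ∀ j k → α j ≢ + 0 → α k ≢ + 0 → SuppPath α j k

  InK : Vec𝕫 r → Set
  InK α = Nonneg α × (¬ (∀ j → α j ≡ + 0)) × (∀ i → pair α i ≤ + 0) × ConnectedSupp α

  -- Φ₊ = positive real roots ∪ positive imaginary roots (= W·K, Kac Thm 5.4)
  data PosRoot (α : Vec𝕫 r) : Set where
    real : IsReal α → Nonneg α → PosRoot α
    imag : (w : Word) (γ : Vec𝕫 r) → InK γ → α ≋ act w γ → PosRoot α

  NegRoot : Vec𝕫 r → Set
  NegRoot α = PosRoot (neg α)

  InPhi : Word → Vec𝕫 r → Set
  InPhi v α = PosRoot α × NegRoot (act v α)

{-# OPTIONS --safe #-}
module Submission where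

-- Because every off-diagonal entry of A is at most −2, W is controlled by a ping-pong argument:
-- if no two adjacent letters of i₁ ⋯ iₖ are equal, then s_{i₁} ⋯ s_{iₖ₋₁} α_{iₖ} is nonnegative
-- with a strict maximum, at least 1, in coordinate i₁, since reflecting in i ≠ c pushes
-- coordinate i above the previous maximum at c. Hence such words are nontrivial, pairwise
-- distinct in W and of minimal length, so every w ≠ 1 is w = v sᵢ with v sᵢ of this form and
-- ℓ(v) = ℓ(w) − 1. It also follows that real roots are positive or negative and that W only
-- raises the elements of Kac's set K, so Φ_v contains no imaginary roots. For a real α ∈ Φ_v,
-- take the letter j of v at which the image of α turns negative: just before it the image β is
-- supported on j alone, and invariance of the form gives (α|αᵢ) = β_j ⟨x, α_j^∨⟩ ≤ 0, where x,
-- the corresponding image of αᵢ, peaks at a letter other than j. If α − αᵢ were real, then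
-- 2 = (α − αᵢ | α − αᵢ) = 4 − 2(α|αᵢ) would force (α|αᵢ) = 1.

open import Defs
open import Data.Nat using (ℕ; _≤_; _<_)
open import Data.Integer using (∣_∣)
open import Data.Fin using (Fin)
open import Data.List using ([]; _∷_; _++_)
open import Data.Product using (Σ; _×_)
open import Relation.Nullary using (¬_)

import Data.Nat as ℕ
import Data.Nat.Properties as ℕ
open import Data.Integer as ℤ using (ℤ; +_; +[1+_]; -[1+_]; _+_; _-_; _*_; -_; 0ℤ; 1ℤ; -1ℤ; +≤+; -≤-; -≤+)
import Data.Integer.Properties as ℤ
open import Data.Integer.Tactic.RingSolver using (solve-∀)
open import Algebra.Properties.Semiring.Sum ℤ.+-*-semiring using (sum; sum-cong-≗; sum-replicate-zero; ∑-distrib-+; *-distribˡ-sum)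
open import Data.Fin using (zero; suc; _≟_)
open import Data.Fin.Properties using (suc-injective)
open import Data.List using (List; length; _∷ʳ_; head)
open import Data.List.Properties using (length-++)
open import Data.List.Reverse using (Reverse; []; _∶_∶ʳ_; reverseView)
open import Data.List.Relation.Unary.Linked using (Linked; []; [-]; _∷_; head′; tail)
open import Data.Maybe using (just)
open import Data.Maybe.Relation.Binary.Connected using (Connected; just; just-nothing)
open import Data.Product using (_,_; proj₁; proj₂)
open import Data.Sum using (_⊎_; inj₁; inj₂)
open import Data.Empty using (⊥-elim)
open import Function using (_∘_)
open import Relation.Nullary using (yes; no; contradiction)
open import Relation.Binary.PropositionalEquality using (_≡_; _≢_; refl; sym; trans; cong; cong₂; subst; ≢-sym; module ≡-Reasoning)

sumFin≡sum : ∀ n (f : Fin n → ℤ) → sumFin n f ≡ sum f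
sumFin≡sum ℕ.zero    f = refl
sumFin≡sum (ℕ.suc n) f = cong (_+_ (f zero)) (sumFin≡sum n (f ∘ suc))

sum-mono-≤ : ∀ {n} {f g : Fin n → ℤ} → (∀ j → f j ℤ.≤ g j) → sum f ℤ.≤ sum g
sum-mono-≤ {ℕ.zero}  f≤g = ℤ.≤-refl
sum-mono-≤ {ℕ.suc n} f≤g = ℤ.+-mono-≤ (f≤g zero) (sum-mono-≤ (f≤g ∘ suc))

sum-zero : ∀ {n} {f : Fin n → ℤ} → (∀ j → f j ≡ 0ℤ) → sum f ≡ 0ℤ
sum-zero {n} f≡0 = trans (sum-cong-≗ f≡0) (sum-replicate-zero n)

sum-supported : ∀ {n} (f : Fin n → ℤ) k → (∀ j → j ≢ k → f j ≡ 0ℤ) → sum f ≡ f k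
sum-supported {ℕ.suc n} f zero    f≡0 =
  trans (cong (_+_ (f zero)) (sum-zero (λ j → f≡0 (suc j) λ ()))) (ℤ.+-identityʳ (f zero))
sum-supported {ℕ.suc n} f (suc k) f≡0 =
  trans (cong₂ _+_ (f≡0 zero λ ()) (sum-supported (f ∘ suc) k (λ j j≢k → f≡0 (suc j) (j≢k ∘ suc-injective))))
        (ℤ.+-identityˡ (f (suc k)))

module _ {r : ℕ} where

  infix 30 _·_⊕_·_
  infix 25 _∙_

  _·_⊕_·_ : ℤ → Vec𝕫 r → ℤ → Vec𝕫 r → Vec𝕫 r
  (c · x ⊕ d · y) j = c * x j + d * y j

  _∙_ : Vec𝕫 r → Vec𝕫 r → ℤ
  x ∙ y = sum (λ j → x j * y j)

  ∙-comm : ∀ x y → x ∙ y ≡ y ∙ x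
  ∙-comm x y = sum-cong-≗ (λ j → ℤ.*-comm (x j) (y j))

  ∙-linˡ : ∀ c x d y z → (c · x ⊕ d · y) ∙ z ≡ c * (x ∙ z) + d * (y ∙ z)
  ∙-linˡ c x d y z = begin
    sum (λ j → (c * x j + d * y j) * z j)             ≡⟨ sum-cong-≗ (λ j → distrib c (x j) d (y j) (z j)) ⟩
    sum (λ j → c * (x j * z j) + d * (y j * z j))     ≡⟨ ∑-distrib-+ (λ j → c * (x j * z j)) (λ j → d * (y j * z j)) ⟩
    sum (λ j → c * (x j * z j)) + sum (λ j → d * (y j * z j))
      ≡⟨ sym (cong₂ _+_ (*-distribˡ-sum c (λ j → x j * z j)) (*-distribˡ-sum d (λ j → y j * z j))) ⟩
    c * (x ∙ z) + d * (y ∙ z)                         ∎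
    where
    open ≡-Reasoning
    distrib : ∀ c x d y z → (c * x + d * y) * z ≡ c * (x * z) + d * (y * z)
    distrib = solve-∀

  ∙-linʳ : ∀ z c x d y → z ∙ (c · x ⊕ d · y) ≡ c * (z ∙ x) + d * (z ∙ y)
  ∙-linʳ z c x d y = begin
    z ∙ (c · x ⊕ d · y)        ≡⟨ ∙-comm z _ ⟩
    (c · x ⊕ d · y) ∙ z        ≡⟨ ∙-linˡ c x d y z ⟩
    c * (x ∙ z) + d * (y ∙ z)  ≡⟨ cong₂ (λ u v → c * u + d * v) (∙-comm x z) (∙-comm y z) ⟩
    c * (z ∙ x) + d * (z ∙ y)  ∎
    where open ≡-Reasoning

  ∙-monoʳ-≤ : ∀ {x y z} → (∀ j → 0ℤ ℤ.≤ x j) → (∀ j → y j ℤ.≤ z j) → x ∙ y ℤ.≤ x ∙ z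
  ∙-monoʳ-≤ {x} x≥0 y≤z = sum-mono-≤ (λ j → ℤ.*-monoˡ-≤-nonNeg (x j) {{ℤ.nonNegative (x≥0 j)}} (y≤z j))

  ∙-supported : ∀ x y k → (∀ j → j ≢ k → x j ≡ 0ℤ) → x ∙ y ≡ x k * y k
  ∙-supported x y k x≡0 = sum-supported _ k (λ j j≢k → cong (_* y j) (x≡0 j j≢k))

first : ∀ {A : Set} → List A → A → A
first []      k = k
first (i ∷ _) k = i

module _ {A : Set} {R : A → A → Set} where

  Linked-++⁻ˡ : ∀ (xs : List A) {ys} → Linked R (xs ++ ys) → Linked R xs
  Linked-++⁻ˡ []           _           = []
  Linked-++⁻ˡ (x ∷ [])     _           = [-]
  Linked-++⁻ˡ (x ∷ y ∷ xs) (Rxy ∷ Rxs) = Rxy ∷ Linked-++⁻ˡ (y ∷ xs) Rxs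

  Linked-∷ʳ⁺ : ∀ (xs : List A) {x k} → Linked R (xs ∷ʳ x) → R x k → Linked R (xs ∷ʳ x ∷ʳ k)
  Linked-∷ʳ⁺ []           _           Rxk = Rxk ∷ [-]
  Linked-∷ʳ⁺ (y ∷ [])     (Ryx ∷ _)   Rxk = Ryx ∷ Rxk ∷ [-]
  Linked-∷ʳ⁺ (y ∷ z ∷ xs) (Ryz ∷ Rxs) Rxk = Ryz ∷ Linked-∷ʳ⁺ (z ∷ xs) Rxs Rxk

  Linked-∷-first : ∀ {x} (xs : List A) {k} → Linked R (x ∷ xs ∷ʳ k) → R x (first xs k)
  Linked-∷-first []      (Rxk ∷ _) = Rxk
  Linked-∷-first (_ ∷ _) (Rxy ∷ _) = Rxy

length-<-∷ʳ : ∀ {A : Set} (xs : List A) x → length xs < length (xs ∷ʳ x)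
length-<-∷ʳ xs x = subst (length xs <_) (sym (length-++ xs)) (ℕ.m<m+n (length xs) (ℕ.s≤s ℕ.z≤n))

≤0∧2≤∣∣⇒≤-2 : ∀ {x} → x ℤ.≤ 0ℤ → 2 ≤ ∣ x ∣ → x ℤ.≤ -[1+ 1 ]
≤0∧2≤∣∣⇒≤-2 {+ 0}      _        ()
≤0∧2≤∣∣⇒≤-2 {+[1+ n ]} (+≤+ ()) _
≤0∧2≤∣∣⇒≤-2 { -[1+ n ]} _        (ℕ.s≤s 1≤n) = -≤- 1≤n

2≢2-2p+2 : ∀ {p} → p ℤ.≤ 0ℤ → + 2 ≢ + 2 - (p + p) + + 2
2≢2-2p+2 {+ 0}      _ ()
2≢2-2p+2 { -[1+ n ]} _ ()
2≢2-2p+2 {+[1+ n ]} (+≤+ ()) _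

module RootLattice {r : ℕ} (a : Matrix r) where

  open KacMoody a renaming (refl to s)

  Nonpos : Vec𝕫 r → Set
  Nonpos x = ∀ j → x j ℤ.≤ 0ℤ

  e-diag : ∀ k → e k k ≡ 1ℤ
  e-diag k with k ≟ k
  ... | yes _   = refl
  ... | no k≢k = contradiction refl k≢k

  e-offdiag : ∀ k j → k ≢ j → e k j ≡ 0ℤ
  e-offdiag k j k≢j with k ≟ j
  ... | yes k≡j = contradiction k≡j k≢j
  ... | no _    = refl

  e-nonneg : ∀ k → Nonneg (e k)
  e-nonneg k j with k ≟ j
  ... | yes _ = +≤+ ℕ.z≤n
  ... | no _  = +≤+ ℕ.z≤n

  e-∙ : ∀ k x → e k ∙ x ≡ x k
  e-∙ k x = trans (∙-supported (e k) x k (λ j j≢k → e-offdiag k j (≢-sym j≢k)))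
                  (trans (cong (_* x k) (e-diag k)) (ℤ.*-identityˡ (x k)))

  ∙-e : ∀ x k → x ∙ e k ≡ x k
  ∙-e x k = trans (∙-comm x (e k)) (e-∙ k x)

  pair-∙ : ∀ x i → pair x i ≡ x ∙ a i
  pair-∙ x i = sumFin≡sum r (λ j → x j * a i j)

  pair-cong : ∀ {x y} i → x ≋ y → pair x i ≡ pair y i
  pair-cong {x} {y} i x≋y = begin
    pair x i  ≡⟨ pair-∙ x i ⟩
    x ∙ a i   ≡⟨ sum-cong-≗ (λ j → cong (_* a i j) (x≋y j)) ⟩
    y ∙ a i   ≡⟨ pair-∙ y i ⟨
    pair y i  ∎
    where open ≡-Reasoning

  pair-lin : ∀ c x d y i → pair (c · x ⊕ d · y) i ≡ c * pair x i + d * pair y i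
  pair-lin c x d y i = begin
    pair (c · x ⊕ d · y) i           ≡⟨ pair-∙ (c · x ⊕ d · y) i ⟩
    (c · x ⊕ d · y) ∙ a i            ≡⟨ ∙-linˡ c x d y (a i) ⟩
    c * (x ∙ a i) + d * (y ∙ a i)    ≡⟨ cong₂ (λ u v → c * u + d * v) (pair-∙ x i) (pair-∙ y i) ⟨
    c * pair x i + d * pair y i      ∎
    where open ≡-Reasoning

  pair-e : ∀ k i → pair (e k) i ≡ a i k
  pair-e k i = trans (pair-∙ (e k) i) (e-∙ k (a i))

  s-comb : ∀ i x → s i x ≋ 1ℤ · x ⊕ (- pair x i) · e i
  s-comb i x j = ring (x j) (pair x i) (e i j)
    where
    ring : ∀ x p ε → x - p * ε ≡ 1ℤ * x + (- p) * ε
    ring = solve-∀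

  s-cong : ∀ i {x y} → x ≋ y → s i x ≋ s i y
  s-cong i x≋y j = cong₂ (λ u p → u - p * e i j) (x≋y j) (pair-cong i x≋y)

  s-lin : ∀ i c x d y → s i (c · x ⊕ d · y) ≋ c · s i x ⊕ d · s i y
  s-lin i c x d y j = trans (cong (λ p → (c * x j + d * y j) - p * e i j) (pair-lin c x d y i))
                            (ring c (x j) d (y j) (pair x i) (pair y i) (e i j))
    where
    ring : ∀ c x d y p q ε → (c * x + d * y) - (c * p + d * q) * ε ≡ c * (x - p * ε) + d * (y - q * ε)
    ring = solve-∀

  s-offdiag : ∀ i x j → j ≢ i → s i x j ≡ x j
  s-offdiag i x j j≢i = begin
    x j - pair x i * e i j  ≡⟨ cong (λ ε → x j - pair x i * ε) (e-offdiag i j (≢-sym j≢i)) ⟩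
    x j - pair x i * 0ℤ     ≡⟨ cong (λ t → x j - t) (ℤ.*-zeroʳ (pair x i)) ⟩
    x j + 0ℤ                ≡⟨ ℤ.+-identityʳ (x j) ⟩
    x j                     ∎
    where open ≡-Reasoning

  s-diag : ∀ i x → s i x i ≡ x i - pair x i
  s-diag i x = trans (cong (λ ε → x i - pair x i * ε) (e-diag i)) (cong (λ t → x i - t) (ℤ.*-identityʳ (pair x i)))

  act-cong : ∀ w {x y} → x ≋ y → act w x ≋ act w y
  act-cong []      x≋y = x≋y
  act-cong (i ∷ w) x≋y = s-cong i (act-cong w x≋y)

  act-++ : ∀ u v x → act (u ++ v) x ≡ act u (act v x)
  act-++ []      v x = refl
  act-++ (i ∷ u) v x = cong (s i) (act-++ u v x)

  act-lin : ∀ w c x d y → act w (c · x ⊕ d · y) ≋ c · act w x ⊕ d · act w y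
  act-lin []      c x d y j = refl
  act-lin (i ∷ w) c x d y j = trans (s-cong i (act-lin w c x d y) j) (s-lin i c (act w x) d (act w y) j)

  act-∷ʳ : ∀ u k x → act (u ∷ʳ k) x ≋ 1ℤ · act u x ⊕ (- pair x k) · act u (e k)
  act-∷ʳ u k x j = begin
    act (u ∷ʳ k) x j                                      ≡⟨ cong (λ y → y j) (act-++ u (k ∷ []) x) ⟩
    act u (s k x) j                                        ≡⟨ act-cong u (s-comb k x) j ⟩
    act u (1ℤ · x ⊕ (- pair x k) · e k) j                   ≡⟨ act-lin u 1ℤ x (- pair x k) (e k) j ⟩
    (1ℤ · act u x ⊕ (- pair x k) · act u (e k)) j           ∎
    where open ≡-Reasoning

  act-real : ∀ w {α} → IsReal α → IsReal (act w α)
  act-real w (z , k , α≋) = w ++ z , k , λ j → trans (act-cong w α≋ j) (cong (λ y → y j) (sym (act-++ w z (e k))))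

  ≈W-refl : ∀ w → w ≈W w
  ≈W-refl w α j = refl

  ≈W-sym : ∀ {u w} → u ≈W w → w ≈W u
  ≈W-sym u≈w α j = sym (u≈w α j)

  module Reflections (diag : ∀ i → a i i ≡ + 2) where

    pair-s : ∀ i x → pair (s i x) i ≡ - pair x i
    pair-s i x = begin
      pair (s i x) i                                  ≡⟨ pair-cong i (s-comb i x) ⟩
      pair (1ℤ · x ⊕ (- pair x i) · e i) i            ≡⟨ pair-lin 1ℤ x (- pair x i) (e i) i ⟩
      1ℤ * pair x i + (- pair x i) * pair (e i) i     ≡⟨ cong (λ t → 1ℤ * pair x i + (- pair x i) * t) (trans (pair-e i i) (diag i)) ⟩
      1ℤ * pair x i + (- pair x i) * + 2              ≡⟨ ring (pair x i) ⟩
      - pair x i                                      ∎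
      where
      open ≡-Reasoning
      ring : ∀ p → 1ℤ * p + (- p) * + 2 ≡ - p
      ring = solve-∀

    s-involutive : ∀ i x → s i (s i x) ≋ x
    s-involutive i x j = trans (cong (λ p → s i x j - p * e i j) (pair-s i x)) (ring (x j) (pair x i) (e i j))
      where
      ring : ∀ x p ε → (x - p * ε) - (- p) * ε ≡ x
      ring = solve-∀

    act-∷ʳ-e : ∀ u k → act (u ∷ʳ k) (e k) ≋ neg (act u (e k))
    act-∷ʳ-e u k j = begin
      act (u ∷ʳ k) (e k) j                                       ≡⟨ act-∷ʳ u k (e k) j ⟩
      1ℤ * act u (e k) j + (- pair (e k) k) * act u (e k) j       ≡⟨ cong (λ p → 1ℤ * act u (e k) j + (- p) * act u (e k) j) (trans (pair-e k k) (diag k)) ⟩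
      1ℤ * act u (e k) j + (- + 2) * act u (e k) j                ≡⟨ ring (act u (e k) j) ⟩
      - act u (e k) j                                            ∎
      where
      open ≡-Reasoning
      ring : ∀ y → 1ℤ * y + (- + 2) * y ≡ - y
      ring = solve-∀

    ∷-cancel-≈W : ∀ i {u w} → (i ∷ u) ≈W (i ∷ w) → u ≈W w
    ∷-cancel-≈W i {u} {w} i∷u≈i∷w α j =
      trans (sym (s-involutive i (act u α) j)) (trans (s-cong i (i∷u≈i∷w α) j) (s-involutive i (act w α) j))

    ≈W-∷-move : ∀ i {u w} → u ≈W (i ∷ w) → (i ∷ u) ≈W w
    ≈W-∷-move i {u} {w} u≈i∷w α j = trans (s-cong i (u≈i∷w α) j) (s-involutive i (act w α) j)

    push : Fin r → Word → Word
    push i []      = i ∷ []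
    push i (j ∷ u) with i ≟ j
    ... | yes _ = u
    ... | no _  = i ∷ j ∷ u

    push-linked : ∀ i {u} → Linked _≢_ u → Linked _≢_ (push i u)
    push-linked i {[]}    _ = [-]
    push-linked i {j ∷ u} l with i ≟ j
    ... | yes _   = tail l
    ... | no i≢j = i≢j ∷ l

    push-length : ∀ i u → length (push i u) ≤ ℕ.suc (length u)
    push-length i []      = ℕ.≤-refl
    push-length i (j ∷ u) with i ≟ j
    ... | yes _ = ℕ.m≤n⇒m≤1+n (ℕ.n≤1+n (length u))
    ... | no _  = ℕ.≤-refl

    push-≈W : ∀ i u → push i u ≈W (i ∷ u)
    push-≈W i []      α j = refl
    push-≈W i (j ∷ u) α m with i ≟ j
    ... | yes refl = sym (s-involutive i (act u α) m)
    ... | no _     = refl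

    reduce : Word → Word
    reduce []      = []
    reduce (i ∷ w) = push i (reduce w)

    reduce-linked : ∀ w → Linked _≢_ (reduce w)
    reduce-linked []      = []
    reduce-linked (i ∷ w) = push-linked i (reduce-linked w)

    reduce-length : ∀ w → length (reduce w) ≤ length w
    reduce-length []      = ℕ.z≤n
    reduce-length (i ∷ w) = ℕ.≤-trans (push-length i (reduce w)) (ℕ.s≤s (reduce-length w))

    reduce-≈W : ∀ w → reduce w ≈W w
    reduce-≈W []      = ≈W-refl []
    reduce-≈W (i ∷ w) α j = trans (push-≈W i (reduce w) α j) (s-cong i (reduce-≈W w α) j)

    reduced-∷ʳ : ∀ w → ¬ (w ≈W []) → Σ Word λ v → Σ (Fin r) λ i → Linked _≢_ (v ∷ʳ i) × ((v ∷ʳ i) ≈W w)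
    reduced-∷ʳ w w≉1 = go (reverseView (reduce w)) (reduce-linked w) (reduce-≈W w)
      where
      go : ∀ {u} → Reverse u → Linked _≢_ u → u ≈W w → Σ Word λ v → Σ (Fin r) λ i → Linked _≢_ (v ∷ʳ i) × ((v ∷ʳ i) ≈W w)
      go []             _ 1≈w     = contradiction (≈W-sym {[]} {w} 1≈w) w≉1
      go (v ∶ _ ∶ʳ i) l v∷ʳi≈w = v , i , l , v∷ʳi≈w

  module InvariantForm (diag : ∀ i → a i i ≡ + 2) (symm : IsSymmetric a) where

    open Reflections diag

    -- For symmetric A this is the invariant form, with (αᵢ|αⱼ) = aᵢⱼ.
    ⟨_∣_⟩ : Vec𝕫 r → Vec𝕫 r → ℤ
    ⟨ x ∣ y ⟩ = x ∙ pair y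

    ⟨⟩-cong : ∀ {x x′ y y′} → x ≋ x′ → y ≋ y′ → ⟨ x ∣ y ⟩ ≡ ⟨ x′ ∣ y′ ⟩
    ⟨⟩-cong x≋x′ y≋y′ = sum-cong-≗ (λ m → cong₂ _*_ (x≋x′ m) (pair-cong m y≋y′))

    ⟨⟩-linˡ : ∀ c x d y z → ⟨ c · x ⊕ d · y ∣ z ⟩ ≡ c * ⟨ x ∣ z ⟩ + d * ⟨ y ∣ z ⟩
    ⟨⟩-linˡ c x d y z = ∙-linˡ c x d y (pair z)

    ⟨⟩-linʳ : ∀ z c x d y → ⟨ z ∣ c · x ⊕ d · y ⟩ ≡ c * ⟨ z ∣ x ⟩ + d * ⟨ z ∣ y ⟩
    ⟨⟩-linʳ z c x d y = trans (sum-cong-≗ (λ m → cong (z m *_) (pair-lin c x d y m))) (∙-linʳ z c (pair x) d (pair y))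

    ⟨e∣⟩ : ∀ k y → ⟨ e k ∣ y ⟩ ≡ pair y k
    ⟨e∣⟩ k y = e-∙ k (pair y)

    ⟨∣e⟩ : ∀ x k → ⟨ x ∣ e k ⟩ ≡ pair x k
    ⟨∣e⟩ x k = begin
      x ∙ pair (e k)  ≡⟨ sum-cong-≗ (λ m → cong (x m *_) (trans (pair-e k m) (symm m k))) ⟩
      x ∙ a k         ≡⟨ pair-∙ x k ⟨
      pair x k        ∎
      where open ≡-Reasoning

    ⟨e∣e⟩ : ∀ k → ⟨ e k ∣ e k ⟩ ≡ + 2
    ⟨e∣e⟩ k = trans (⟨e∣⟩ k (e k)) (trans (pair-e k k) (diag k))

    ⟨⟩-s : ∀ i x y → ⟨ s i x ∣ s i y ⟩ ≡ ⟨ x ∣ y ⟩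
    ⟨⟩-s i x y = begin
      ⟨ s i x ∣ s i y ⟩                                          ≡⟨ ⟨⟩-cong (s-comb i x) (s-comb i y) ⟩
      ⟨ 1ℤ · x ⊕ (- p) · e i ∣ 1ℤ · y ⊕ (- q) · e i ⟩            ≡⟨ ⟨⟩-linˡ 1ℤ x (- p) (e i) (1ℤ · y ⊕ (- q) · e i) ⟩
      1ℤ * ⟨ x ∣ 1ℤ · y ⊕ (- q) · e i ⟩ + (- p) * ⟨ e i ∣ 1ℤ · y ⊕ (- q) · e i ⟩
        ≡⟨ cong₂ (λ u v → 1ℤ * u + (- p) * v) (⟨⟩-linʳ x 1ℤ y (- q) (e i)) (⟨⟩-linʳ (e i) 1ℤ y (- q) (e i)) ⟩
      1ℤ * (1ℤ * ⟨ x ∣ y ⟩ + (- q) * ⟨ x ∣ e i ⟩) + (- p) * (1ℤ * ⟨ e i ∣ y ⟩ + (- q) * ⟨ e i ∣ e i ⟩)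
        ≡⟨ cong₂ (λ u v → 1ℤ * (1ℤ * ⟨ x ∣ y ⟩ + (- q) * u) + (- p) * v) (⟨∣e⟩ x i)
                 (cong₂ (λ u v → 1ℤ * u + (- q) * v) (⟨e∣⟩ i y) (⟨e∣e⟩ i)) ⟩
      1ℤ * (1ℤ * ⟨ x ∣ y ⟩ + (- q) * p) + (- p) * (1ℤ * q + (- q) * + 2)
        ≡⟨ ring ⟨ x ∣ y ⟩ p q ⟩
      ⟨ x ∣ y ⟩                                                  ∎
      where
      open ≡-Reasoning
      p = pair x i
      q = pair y i
      ring : ∀ b p q → 1ℤ * (1ℤ * b + (- q) * p) + (- p) * (1ℤ * q + (- q) * + 2) ≡ b
      ring = solve-∀

    ⟨⟩-act : ∀ w x y → ⟨ act w x ∣ act w y ⟩ ≡ ⟨ x ∣ y ⟩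
    ⟨⟩-act []      x y = refl
    ⟨⟩-act (i ∷ w) x y = trans (⟨⟩-s i (act w x) (act w y)) (⟨⟩-act w x y)

    real-norm : ∀ {α} → IsReal α → ⟨ α ∣ α ⟩ ≡ + 2
    real-norm (z , k , α≋) = trans (⟨⟩-cong α≋ α≋) (trans (⟨⟩-act z (e k) (e k)) (⟨e∣e⟩ k))

    real-nonzero : ∀ {α} → IsReal α → ¬ (∀ j → α j ≡ 0ℤ)
    real-nonzero {α} R α≡0 with trans (sym (real-norm R)) (sum-zero (λ j → cong (_* pair α j) (α≡0 j)))
    ... | ()

    ⟨⟩-supported : ∀ {β} j y → (∀ m → m ≢ j → β m ≡ 0ℤ) → ⟨ β ∣ y ⟩ ≡ β j * pair y j
    ⟨⟩-supported {β} j y β≡0 = ∙-supported β (pair y) j β≡0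

    ⟨⊖e∣⊖e⟩ : ∀ α i → ⟨ α ⊖ e i ∣ α ⊖ e i ⟩ ≡ ⟨ α ∣ α ⟩ - (pair α i + pair α i) + + 2
    ⟨⊖e∣⊖e⟩ α i = begin
      ⟨ α ⊖ e i ∣ α ⊖ e i ⟩                                       ≡⟨ ⟨⟩-cong ⊖-comb ⊖-comb ⟩
      ⟨ 1ℤ · α ⊕ -1ℤ · e i ∣ 1ℤ · α ⊕ -1ℤ · e i ⟩                 ≡⟨ ⟨⟩-linˡ 1ℤ α -1ℤ (e i) (1ℤ · α ⊕ -1ℤ · e i) ⟩
      1ℤ * ⟨ α ∣ 1ℤ · α ⊕ -1ℤ · e i ⟩ + -1ℤ * ⟨ e i ∣ 1ℤ · α ⊕ -1ℤ · e i ⟩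
        ≡⟨ cong₂ (λ u v → 1ℤ * u + -1ℤ * v) (⟨⟩-linʳ α 1ℤ α -1ℤ (e i)) (⟨⟩-linʳ (e i) 1ℤ α -1ℤ (e i)) ⟩
      1ℤ * (1ℤ * ⟨ α ∣ α ⟩ + -1ℤ * ⟨ α ∣ e i ⟩) + -1ℤ * (1ℤ * ⟨ e i ∣ α ⟩ + -1ℤ * ⟨ e i ∣ e i ⟩)
        ≡⟨ cong₂ (λ u v → 1ℤ * (1ℤ * ⟨ α ∣ α ⟩ + -1ℤ * u) + -1ℤ * v) (⟨∣e⟩ α i)
                 (cong₂ (λ u v → 1ℤ * u + -1ℤ * v) (⟨e∣⟩ i α) (⟨e∣e⟩ i)) ⟩
      1ℤ * (1ℤ * ⟨ α ∣ α ⟩ + -1ℤ * p) + -1ℤ * (1ℤ * p + -1ℤ * + 2)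
        ≡⟨ ring ⟨ α ∣ α ⟩ p ⟩
      ⟨ α ∣ α ⟩ - (p + p) + + 2                                   ∎
      where
      open ≡-Reasoning
      p = pair α i
      ⊖-comb : (α ⊖ e i) ≋ 1ℤ · α ⊕ -1ℤ · e i
      ⊖-comb j = sub-as-comb (α j) (e i j)
        where
        sub-as-comb : ∀ x y → x - y ≡ 1ℤ * x + -1ℤ * y
        sub-as-comb = solve-∀
      ring : ∀ n p → 1ℤ * (1ℤ * n + -1ℤ * p) + -1ℤ * (1ℤ * p + -1ℤ * + 2) ≡ n - (p + p) + + 2
      ring = solve-∀

  module PingPong (diag : ∀ i → a i i ≡ + 2) (off : ∀ i j → i ≢ j → a i j ℤ.≤ -[1+ 1 ]) where

    open Reflections diag

    row-bound : ∀ {i c} → i ≢ c → ∀ j → a i j ℤ.≤ ((+ 2) · e i ⊕ -[1+ 1 ] · e c) j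
    row-bound {i} {c} i≢c j with j ≟ i | j ≟ c
    ... | yes refl | _ rewrite diag j | e-diag j | e-offdiag c j (≢-sym i≢c) = ℤ.≤-refl
    ... | no j≢i | yes refl rewrite e-offdiag i j i≢c | e-diag j = off i j i≢c
    ... | no j≢i | no j≢c rewrite e-offdiag i j (≢-sym j≢i) | e-offdiag c j (≢-sym j≢c) =
      ℤ.≤-trans (off i j (≢-sym j≢i)) -≤+

    pair-bound : ∀ {x i c} → Nonneg x → i ≢ c → pair x i ℤ.≤ + 2 * x i + -[1+ 1 ] * x c
    pair-bound {x} {i} {c} x≥0 i≢c = begin
      pair x i                                      ≡⟨ pair-∙ x i ⟩
      x ∙ a i                                       ≤⟨ ∙-monoʳ-≤ x≥0 (row-bound i≢c) ⟩
      x ∙ ((+ 2) · e i ⊕ -[1+ 1 ] · e c)            ≡⟨ ∙-linʳ x (+ 2) (e i) -[1+ 1 ] (e c) ⟩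
      + 2 * (x ∙ e i) + -[1+ 1 ] * (x ∙ e c)        ≡⟨ cong₂ (λ u v → + 2 * u + -[1+ 1 ] * v) (∙-e x i) (∙-e x c) ⟩
      + 2 * x i + -[1+ 1 ] * x c                    ∎
      where open ℤ.≤-Reasoning

    StrictPeak : Vec𝕫 r → Fin r → Set
    StrictPeak x c = Nonneg x × (1ℤ ℤ.≤ x c) × (∀ j → j ≢ c → x j ℤ.< x c)

    StrictPeak-e : ∀ k → StrictPeak (e k) k
    StrictPeak-e k = e-nonneg k , ℤ.≤-reflexive (sym (e-diag k)) , e<e-diag
      where
      e<e-diag : ∀ j → j ≢ k → e k j ℤ.< e k k
      e<e-diag j j≢k rewrite e-offdiag k j (≢-sym j≢k) | e-diag k = ℤ.+<+ (ℕ.s≤s ℕ.z≤n)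

    pair-<0 : ∀ {x c j} → StrictPeak x c → j ≢ c → pair x j ℤ.< 0ℤ
    pair-<0 {x} {c} {j} (x≥0 , _ , x<xc) j≢c = begin-strict
      pair x j                          ≤⟨ pair-bound x≥0 j≢c ⟩
      + 2 * x j + -[1+ 1 ] * x c        <⟨ ℤ.+-monoˡ-< (-[1+ 1 ] * x c) (ℤ.*-monoˡ-<-pos (+ 2) (x<xc j j≢c)) ⟩
      + 2 * x c + -[1+ 1 ] * x c        ≡⟨ ring (x c) ⟩
      0ℤ                                ∎
      where
      open ℤ.≤-Reasoning
      ring : ∀ y → + 2 * y + -[1+ 1 ] * y ≡ 0ℤ
      ring = solve-∀

    StrictPeak-s : ∀ {x c i} → i ≢ c → StrictPeak x c → StrictPeak (s i x) i
    StrictPeak-s {x} {c} {i} i≢c (x≥0 , 1≤xc , x<xc) = sx≥0 , ℤ.≤-trans 1≤xc (ℤ.<⇒≤ xc<sxi) , sx<sxi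
      where
      open ℤ.≤-Reasoning
      xc<sxi : x c ℤ.< s i x i
      xc<sxi = begin-strict
        x c                                        ≡⟨ ring₁ (x c) (x i) ⟩
        x c + x i - x i                            <⟨ ℤ.+-monoˡ-< (- x i) (ℤ.+-monoʳ-< (x c) (x<xc i i≢c)) ⟩
        x c + x c - x i                            ≡⟨ ring₂ (x c) (x i) ⟩
        x i - (+ 2 * x i + -[1+ 1 ] * x c)         ≤⟨ ℤ.+-monoʳ-≤ (x i) (ℤ.neg-mono-≤ (pair-bound x≥0 i≢c)) ⟩
        x i - pair x i                             ≡⟨ s-diag i x ⟨
        s i x i                                    ∎
        where
        ring₁ : ∀ c i → c ≡ c + i - i
        ring₁ = solve-∀
        ring₂ : ∀ c i → c + c - i ≡ i - (+ 2 * i + -[1+ 1 ] * c)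
        ring₂ = solve-∀
      sx≥0 : Nonneg (s i x)
      sx≥0 j with j ≟ i
      ... | yes refl = ℤ.≤-trans (x≥0 c) (ℤ.<⇒≤ xc<sxi)
      ... | no j≢i  = ℤ.≤-trans (x≥0 j) (ℤ.≤-reflexive (sym (s-offdiag i x j j≢i)))
      sx<sxi : ∀ j → j ≢ i → s i x j ℤ.< s i x i
      sx<sxi j j≢i = begin-strict
        s i x j  ≡⟨ s-offdiag i x j j≢i ⟩
        x j      ≤⟨ x≤xc j ⟩
        x c      <⟨ xc<sxi ⟩
        s i x i  ∎
        where
        x≤xc : ∀ j → x j ℤ.≤ x c
        x≤xc j with j ≟ c
        ... | yes refl = ℤ.≤-refl
        ... | no j≢c  = ℤ.<⇒≤ (x<xc j j≢c)

    peak : ∀ u k → Linked _≢_ (u ∷ʳ k) → StrictPeak (act u (e k)) (first u k)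
    peak []      k _ = StrictPeak-e k
    peak (i ∷ u) k l = StrictPeak-s (Linked-∷-first u l) (peak u k (tail l))

    act-e-nonneg : ∀ u k → Linked _≢_ (u ∷ʳ k) → Nonneg (act u (e k))
    act-e-nonneg u k l = proj₁ (peak u k l)

    linked-∷ʳ-nontrivial : ∀ u k → Linked _≢_ (u ∷ʳ k) → ¬ ((u ∷ʳ k) ≈W [])
    linked-∷ʳ-nontrivial u k l u∷ʳk≈1 = contradiction (ℤ.≤-trans 1≤xc xc≤0) λ { (+≤+ ()) }
      where
      c = first u k
      1≤xc : 1ℤ ℤ.≤ act u (e k) c
      1≤xc = proj₁ (proj₂ (peak u k l))
      xc≤0 : act u (e k) c ℤ.≤ 0ℤ
      xc≤0 = ℤ.neg-cancel-≤ (subst (0ℤ ℤ.≤_) (trans (sym (u∷ʳk≈1 (e k) c)) (act-∷ʳ-e u k c)) (e-nonneg k c))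

    linked-≈W-[] : ∀ {w} → Linked _≢_ w → w ≈W [] → w ≡ []
    linked-≈W-[] {w} l w≈1 = go (reverseView w) l w≈1
      where
      go : ∀ {w} → Reverse w → Linked _≢_ w → w ≈W [] → w ≡ []
      go []              _ _   = refl
      go (u ∶ _ ∶ʳ k) l w≈1 = contradiction w≈1 (linked-∷ʳ-nontrivial u k l)

    linked-≉-∷ : ∀ {i u} w → Linked _≢_ (i ∷ u) → Linked _≢_ w → Connected _≢_ (just i) (head w) → ¬ ((i ∷ u) ≈W w)
    linked-≉-∷ []      l _  _          i∷u≈w with linked-≈W-[] l i∷u≈w
    ... | ()
    linked-≉-∷ {i} {u} (j ∷ w) l lw (just i≢j) i∷u≈w =
      linked-≉-∷ w (≢-sym i≢j ∷ l) (tail lw) (head′ lw) (≈W-∷-move j {i ∷ u} {w} i∷u≈w)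

    linked-unique : ∀ {u w} → Linked _≢_ u → Linked _≢_ w → u ≈W w → u ≡ w
    linked-unique {[]}    {[]}    _  _  _   = refl
    linked-unique {[]}    {j ∷ w} _  lw u≈w = contradiction (≈W-sym {[]} {j ∷ w} u≈w) (linked-≉-∷ [] lw [] just-nothing)
    linked-unique {i ∷ u} {[]}    lu _  u≈w = contradiction u≈w (linked-≉-∷ [] lu [] just-nothing)
    linked-unique {i ∷ u} {j ∷ w} lu lw u≈w with i ≟ j
    ... | yes refl = cong (i ∷_) (linked-unique (tail lu) (tail lw) (∷-cancel-≈W i {u} {w} u≈w))
    ... | no i≢j  = contradiction u≈w (linked-≉-∷ (j ∷ w) lu lw (just i≢j))

    linked-isLength : ∀ {u w} → Linked _≢_ u → u ≈W w → IsLength w (length u)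
    linked-isLength {u} {w} lu u≈w = (u , u≈w , refl) , minimal
      where
      minimal : ∀ w′ → w′ ≈W w → length u ≤ length w′
      minimal w′ w′≈w =
        subst (λ v → length v ≤ length w′) (linked-unique (reduce-linked w′) lu reduce-w′≈u) (reduce-length w′)
        where
        reduce-w′≈u : reduce w′ ≈W u
        reduce-w′≈u α j = trans (reduce-≈W w′ α j) (trans (w′≈w α j) (sym (u≈w α j)))

    linked-∷ʳ⊎ends-with : ∀ u k → Linked _≢_ u → Linked _≢_ (u ∷ʳ k) ⊎ Σ Word (λ v → u ≡ v ∷ʳ k)
    linked-∷ʳ⊎ends-with u k = go (reverseView u)
      where
      go : ∀ {u} → Reverse u → Linked _≢_ u → Linked _≢_ (u ∷ʳ k) ⊎ Σ Word (λ v → u ≡ v ∷ʳ k)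
      go []             _ = inj₁ [-]
      go (v ∶ _ ∶ʳ x) l with x ≟ k
      ... | yes refl = inj₂ (v , refl)
      ... | no x≢k  = inj₁ (Linked-∷ʳ⁺ v l x≢k)

    real-sign : ∀ {β} → IsReal β → Nonneg β ⊎ Nonpos β
    real-sign {β} (z , k , β≋) with linked-∷ʳ⊎ends-with (reduce z) k (reduce-linked z)
    ... | inj₁ l = inj₁ λ j → subst (0ℤ ℤ.≤_) (sym (β≡ j)) (act-e-nonneg (reduce z) k l j)
      where
      β≡ : β ≋ act (reduce z) (e k)
      β≡ j = trans (β≋ j) (sym (reduce-≈W z (e k) j))
    ... | inj₂ (v , reduce-z≡v∷ʳk) = inj₂ λ j → subst (ℤ._≤ 0ℤ) (sym (β≡ j)) (ℤ.neg-mono-≤ (act-e-nonneg v k l j))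
      where
      l : Linked _≢_ (v ∷ʳ k)
      l = subst (Linked _≢_) reduce-z≡v∷ʳk (reduce-linked z)
      β≡ : β ≋ neg (act v (e k))
      β≡ j = trans (β≋ j) (trans (sym (reduce-≈W z (e k) j))
                (trans (cong (λ w → act w (e k) j) reduce-z≡v∷ʳk) (act-∷ʳ-e v k j)))

    antidominant-≤-act : ∀ {γ} → (∀ i → pair γ i ℤ.≤ 0ℤ) → ∀ w j → γ j ℤ.≤ act w γ j
    antidominant-≤-act {γ} γ⁻ w j =
      subst (γ j ℤ.≤_) (reduce-≈W w γ j) (go (reverseView (reduce w)) (reduce-linked w) j)
      where
      go : ∀ {u} → Reverse u → Linked _≢_ u → ∀ j → γ j ℤ.≤ act u γ j
      go []              _ j = ℤ.≤-refl
      go (u ∶ ru ∶ʳ k) l j = begin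
        γ j                                                   ≤⟨ go ru (Linked-++⁻ˡ u l) j ⟩
        act u γ j                                             ≡⟨ ℤ.*-identityˡ (act u γ j) ⟨
        1ℤ * act u γ j                                        ≤⟨ ℤ.i≤i+j _ _ {{ℤ.nonNegative c≥0}} ⟩
        1ℤ * act u γ j + (- pair γ k) * act u (e k) j         ≡⟨ act-∷ʳ u k γ j ⟨
        act (u ∷ʳ k) γ j                                      ∎
        where
        open ℤ.≤-Reasoning
        c≥0 : 0ℤ ℤ.≤ (- pair γ k) * act u (e k) j
        c≥0 = subst (ℤ._≤ (- pair γ k) * act u (e k) j) (ℤ.*-zeroʳ (- pair γ k))
                (ℤ.*-monoˡ-≤-nonNeg (- pair γ k) {{ℤ.nonNegative (ℤ.neg-mono-≤ (γ⁻ k))}} (act-e-nonneg u k l j))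

    posroot-nonneg : ∀ {α} → PosRoot α → Nonneg α
    posroot-nonneg (real _ α≥0) = α≥0
    posroot-nonneg (imag w γ (γ≥0 , _ , γ⁻ , _) α≋) j =
      subst (0ℤ ℤ.≤_) (sym (α≋ j)) (ℤ.≤-trans (γ≥0 j) (antidominant-≤-act γ⁻ w j))

    negroot-nonpos : ∀ {α} → NegRoot α → Nonpos α
    negroot-nonpos {α} nα j = ℤ.neg-cancel-≤ {0ℤ} {α j} (posroot-nonneg nα j)

  module RootDifferences (diag : ∀ i → a i i ≡ + 2) (off : ∀ i j → i ≢ j → a i j ℤ.≤ -[1+ 1 ]) (symm : IsSymmetric a) where

    open Reflections diag
    open InvariantForm diag symm
    open PingPong diag off

    real-pair-nonpos : ∀ v i {α} → Linked _≢_ (v ∷ʳ i) → IsReal α → Nonneg α → Nonpos (act v α) → pair α i ℤ.≤ 0ℤ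
    real-pair-nonpos []      i _ R α≥0 α≤0 = ⊥-elim (real-nonzero R (λ j → ℤ.≤-antisym (α≤0 j) (α≥0 j)))
    real-pair-nonpos (j ∷ v) i {α} l R α≥0 sβ≤0 with real-sign (act-real v R)
    ... | inj₂ β≤0 = real-pair-nonpos v i (tail l) R α≥0 β≤0
    ... | inj₁ β≥0 = begin
      pair α i            ≡⟨ ⟨∣e⟩ α i ⟨
      ⟨ α ∣ e i ⟩         ≡⟨ ⟨⟩-act v α (e i) ⟨
      ⟨ β ∣ x ⟩           ≡⟨ ⟨⟩-supported j x β-supported ⟩
      β j * pair x j      ≤⟨ ℤ.*-monoˡ-≤-nonNeg (β j) {{ℤ.nonNegative (β≥0 j)}} (ℤ.<⇒≤ (pair-<0 (peak v i (tail l)) (Linked-∷-first v l))) ⟩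
      β j * 0ℤ            ≡⟨ ℤ.*-zeroʳ (β j) ⟩
      0ℤ                  ∎
      where
      open ℤ.≤-Reasoning
      β = act v α
      x = act v (e i)
      β-supported : ∀ m → m ≢ j → β m ≡ 0ℤ
      β-supported m m≢j = ℤ.≤-antisym (subst (ℤ._≤ 0ℤ) (s-offdiag j β m m≢j) (sβ≤0 m)) (β≥0 m)

    Φ-⊖e-not-real : ∀ v i → Linked _≢_ (v ∷ʳ i) → ∀ α → InPhi v α → ¬ IsReal (α ⊖ e i)
    Φ-⊖e-not-real v i l α (real R α≥0 , nα) R′ =
      2≢2-2p+2 (real-pair-nonpos v i l R α≥0 (negroot-nonpos nα)) (begin
        + 2                                          ≡⟨ real-norm R′ ⟨
        ⟨ α ⊖ e i ∣ α ⊖ e i ⟩                        ≡⟨ ⟨⊖e∣⊖e⟩ α i ⟩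
        ⟨ α ∣ α ⟩ - (pair α i + pair α i) + + 2      ≡⟨ cong (λ n → n - (pair α i + pair α i) + + 2) (real-norm R) ⟩
        + 2 - (pair α i + pair α i) + + 2            ∎)
      where open ≡-Reasoning
    Φ-⊖e-not-real v i l α (imag u γ (γ≥0 , γ≢0 , γ⁻ , _) α≋ , nα) _ =
      γ≢0 (λ j → ℤ.≤-antisym (γ≤0 j) (γ≥0 j))
      where
      γ≤0 : Nonpos γ
      γ≤0 j = begin
        γ j                 ≤⟨ antidominant-≤-act γ⁻ (v ++ u) j ⟩
        act (v ++ u) γ j    ≡⟨ cong (λ y → y j) (act-++ v u γ) ⟩
        act v (act u γ) j   ≡⟨ act-cong v α≋ j ⟨
        act v α j           ≤⟨ negroot-nonpos nα j ⟩
        0ℤ                  ∎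
        where open ℤ.≤-Reasoning

proposition4p3 : (r : ℕ) (a : Matrix r) → IsGCM a → IsSymmetric a → IsNonsingular a
    → (∀ i j → 2 ≤ ∣ a i j ∣)
    → let open KacMoody a in
    ∀ (w : Word) → ¬ (w ≈W [])
    → Σ Word λ v → Σ (Fin r) λ i →
    (w ≈W (v ++ (i ∷ [])))
    × (Σ ℕ λ m → Σ ℕ λ n → IsLength v m × IsLength w n × m < n)
    × (∀ α → InPhi v α → ¬ IsReal (α ⊖ e i))
proposition4p3 r a gcm symm _ big w w≉1 =
  let (v , i , l , v∷ʳi≈w) = reduced-∷ʳ w w≉1 in
  v , i , ≈W-sym {v ∷ʳ i} {w} v∷ʳi≈w
  , (length v , length (v ∷ʳ i)
    , linked-isLength {w = v} (Linked-++⁻ˡ v l) (≈W-refl v) , linked-isLength {w = w} l v∷ʳi≈w , length-<-∷ʳ v i)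
  , Φ-⊖e-not-real v i l
  where
  open RootLattice a
  diag : ∀ i → a i i ≡ + 2
  diag = IsGCM.diag gcm
  off : ∀ i j → i ≢ j → a i j ℤ.≤ -[1+ 1 ]
  off i j i≢j = ≤0∧2≤∣∣⇒≤-2 (IsGCM.offdiag gcm i j i≢j) (big i j)
  open Reflections diag
  open PingPong diag off
  open RootDifferences diag off symm
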